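{- For every odd integer $k\ge 3$, a tight $\mathrm{CDCCD}(2k-3,k,k-2)$ exists.
   Context: A circular double change covering design $\mathrm{CDCCD}(v,k,b)$ (strength 2) is a $v$-set $V$ with an ordered list $(B_1,\dots,B_b)$ of $k$-subsets of $V$ (blocks) such that every 2-subset of $V$ lies in at least one block, $|B_i\setminus B_{i+1}|=|B_{i+1}\setminus B_i|=2$ for $1\le i<b$, and $|B_b\setminus B_1|=|B_1\setminus B_b|=2$. Let $g_2(v,k)=\lceil\binom v2/(2k-3)\rceil$. A CDCCD is economical if $b=g_2(v,k)$, and tight if it is economical and $\binom v2/(2k-3)$ is an integer. -}

module Defs where

open import Data.Nat using (ℕ; zero; suc; _+_; _*_; _∸_; _≤_; _<_; _/_)
open import Data.Nat.Properties using (<-trans; n<1+n)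
open import Data.Nat.Divisibility using (_∣_)
open import Data.Nat.Combinatorics using (_C_)
open import Data.Fin using (Fin; toℕ; fromℕ<)
open import Data.Fin.Subset using (Subset; _∈_; _─_; ∣_∣)
open import Data.Product using (Σ; _×_)
open import Relation.Binary.PropositionalEquality using (_≡_)

-- ⌈ n / d ⌉ for d ≥ 1 (returns 0 for d = 0, never used)
ceilDiv : ℕ → ℕ → ℕ
ceilDiv n zero    = 0
ceilDiv n (suc d) = (n + d) / suc d

g₂ : ℕ → ℕ → ℕ
g₂ v k = ceilDiv (v C 2) (2 * k ∸ 3)

DoubleChange : ∀ {v} → Subset v → Subset v → Set
DoubleChange A B = (∣ A ─ B ∣ ≡ 2) × (∣ B ─ A ∣ ≡ 2)

record CDCCD (v k b : ℕ) : Set where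
  field
    block      : Fin b → Subset v
    blockSize  : ∀ i → ∣ block i ∣ ≡ k
    covers     : ∀ (x y : Fin v) → Σ (Fin b) (λ i → (x ∈ block i) × (y ∈ block i))
    consecutive : ∀ (i : ℕ) (h : suc i < b) →
      DoubleChange (block (fromℕ< (<-trans (n<1+n i) h)))
                   (block (fromℕ< h))
    circular   : ∀ (h₀ : 0 < b) (hb : b ∸ 1 < b) → 2 ≤ b →
      DoubleChange (block (fromℕ< hb)) (block (fromℕ< h₀))

Economical : ℕ → ℕ → ℕ → Set
Economical v k b = b ≡ g₂ v k

Tight : ℕ → ℕ → ℕ → Set
Tight v k b = Economical v k b × ((2 * k ∸ 3) ∣ (v C 2))

{-# OPTIONS --safe #-}
module Submission where

-- Write k = 2p + 3 and N = 2p + 1 = k − 2, and take as points two copies of ℤ_N and a point ∞.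
-- The N cyclic windows {i, …, i + p} of ℤ_N have p + 1 points, any two points of ℤ_N lie in a
-- common window (their cyclic distance is at most p), and cyclically consecutive windows differ
-- by one point in each direction. Block i is window i in both copies together with ∞: it has
-- 2(p + 1) + 1 = k points, the blocks cover all pairs, and consecutive blocks differ by two
-- points each way. Since C(2N + 1, 2) = N (2N + 1) = b (2k − 3), the design is tight.

open import Defs
open import Data.Bool using (Bool; true; false; _∧_; _∨_; not; if_then_else_)
open import Data.Bool.Properties using (∧-comm; ∧-zeroʳ; not-involutive; ∨-∧-booleanAlgebra)
open import Algebra.Lattice.Properties.BooleanAlgebra ∨-∧-booleanAlgebra using (deMorgan₂)
open import Data.Fin using (Fin; toℕ; fromℕ<; splitAt) renaming (zero to fzero)
open import Data.Fin.Properties using (toℕ-fromℕ<; toℕ<n)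
open import Data.Fin.Subset using (Subset; _∈_; _─_; ∣_∣; inside; outside)
open import Data.Maybe using (Maybe; just; nothing; maybe)
open import Data.Maybe.Relation.Unary.All using (All; just; nothing)
open import Data.Nat using (ℕ; zero; suc; _+_; _*_; _∸_; _≤_; _<_; _<ᵇ_; z≤n; s≤s; z<s; _≤?_; NonZero; >-nonZero)
open import Data.Nat.Combinatorics using (_C_; nC1≡n; nCk+nC[k+1]≡[n+1]C[k+1])
open import Data.Nat.Divisibility using (_∣_; divides)
open import Data.Nat.DivMod using (_/_; m*n/n≡m; m<n⇒m/n≡0; +-distrib-/-∣ˡ)
open import Data.Nat.Properties
open import Data.Nat.Tactic.RingSolver using (solve-∀)
open import Data.Product using (Σ; _×_; _,_)
open import Data.Sum using (inj₁; inj₂)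
open import Data.Vec using ([]; _∷_; _++_; [_]; tabulate; lookup)
open import Data.Vec.Properties using (zipWith-++; lookup-splitAt; lookup∘tabulate; lookup⇒[]=; []=⇒lookup)
open import Function using (_∘_)
open import Relation.Binary.PropositionalEquality using (_≡_; refl; sym; trans; cong; cong₂; subst; subst₂; module ≡-Reasoning)
open import Relation.Nullary using (yes; no; does; contradiction)
open import Relation.Nullary.Decidable using (dec-true; dec-false)

private variable
  a b c i x n : ℕ

count : (ℕ → Bool) → ℕ → ℕ
count f zero    = zero
count f (suc L) = if f zero then suc (count (f ∘ suc) L) else count (f ∘ suc) L

count-cong : ∀ L {f g} → (∀ x → f x ≡ g x) → count f L ≡ count g L
count-cong zero    f≗g = refl
count-cong (suc L) {f} {g} f≗g rewrite f≗g zero | count-cong L {f ∘ suc} {g ∘ suc} (f≗g ∘ suc) = refl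

count-not : ∀ f L → count f L + count (not ∘ f) L ≡ L
count-not f zero = refl
count-not f (suc L) with f zero
... | true  = cong suc (count-not (f ∘ suc) L)
... | false = trans (+-suc _ _) (cong suc (count-not (f ∘ suc) L))

interval : ℕ → ℕ → ℕ → Bool
interval zero    c x       = x <ᵇ c
interval (suc a) c zero    = false
interval (suc a) c (suc x) = interval a c x

interval-≤< : a ≤ x → x < a + c → interval a c x ≡ true
interval-≤< {zero}  {zero}  {suc c} _ _ = refl
interval-≤< {zero}  {suc x} {suc c} _ (s≤s x<c) = interval-≤< {zero} {x} {c} z≤n x<c
interval-≤< {suc a} {suc x} (s≤s a≤x) (s≤s x<a+c) = interval-≤< {a} {x} a≤x x<a+c

interval-< : x < a → interval a c x ≡ false
interval-< {zero}  {suc a} _ = refl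
interval-< {suc x} {suc a} (s≤s x<a) = interval-< {x} {a} x<a

interval-≥ : a + c ≤ x → interval a c x ≡ false
interval-≥ {zero}  {zero}  _ = refl
interval-≥ {zero}  {suc c} {suc x} (s≤s c≤x) = interval-≥ {zero} {c} {x} c≤x
interval-≥ {suc a} {c} {suc x} (s≤s a+c≤x) = interval-≥ {a} {c} {x} a+c≤x

count-interval : ∀ a c L → a + c ≤ L → count (interval a c) L ≡ c
count-interval zero    zero    zero    _           = refl
count-interval zero    zero    (suc L) _           = count-interval zero zero L z≤n
count-interval zero    (suc c) (suc L) (s≤s c≤L)   = cong suc (count-interval zero c L c≤L)
count-interval (suc a) c       (suc L) (s≤s a+c≤L) = count-interval a c L a+c≤L

count-point : ∀ a L → a < L → count (interval a 1) L ≡ 1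
count-point a L a<L = count-interval a 1 L (subst (_≤ L) (+-comm 1 a) a<L)

count-complement : ∀ a c L → a + c ≤ L → count (not ∘ interval a c) L ≡ L ∸ c
count-complement a c L a+c≤L = begin
  count (not ∘ interval a c) L                              ≡⟨ m+n∸m≡n c _ ⟨
  c + count (not ∘ interval a c) L ∸ c                      ≡⟨ cong (λ m → m + count (not ∘ interval a c) L ∸ c) (count-interval a c L a+c≤L) ⟨
  count (interval a c) L + count (not ∘ interval a c) L ∸ c ≡⟨ cong (_∸ c) (count-not (interval a c) L) ⟩
  L ∸ c                                                     ∎
  where open ≡-Reasoning

interval-shiftˡ : ∀ a c x .{{_ : NonZero c}} →
  interval a c x ∧ not (interval (suc a) c x) ≡ interval a 1 x
interval-shiftˡ zero    (suc c) zero    = refl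
interval-shiftˡ zero    (suc c) (suc x) = last-dropped c x
  where
  last-dropped : ∀ c x → (x <ᵇ c) ∧ not (x <ᵇ suc c) ≡ false
  last-dropped zero    zero    = refl
  last-dropped (suc c) zero    = refl
  last-dropped zero    (suc x) = refl
  last-dropped (suc c) (suc x) = last-dropped c x
interval-shiftˡ (suc a) c zero    = refl
interval-shiftˡ (suc a) c (suc x) = interval-shiftˡ a c x

interval-shiftʳ : ∀ a c x .{{_ : NonZero c}} →
  interval (suc a) c x ∧ not (interval a c x) ≡ interval (a + c) 1 x
interval-shiftʳ zero    (suc c) zero    = refl
interval-shiftʳ zero    (suc c) (suc x) = last-added c x
  where
  last-added : ∀ c x → (x <ᵇ suc c) ∧ not (x <ᵇ c) ≡ interval c 1 x
  last-added zero    zero    = refl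
  last-added zero    (suc x) = refl
  last-added (suc c) zero    = refl
  last-added (suc c) (suc x) = last-added c x
interval-shiftʳ (suc a) c zero    = refl
interval-shiftʳ (suc a) c (suc x) = interval-shiftʳ a c x

interval-meet : ∀ b a c x → interval (b + a) (suc c) x ∧ interval b (suc a) x ≡ interval (b + a) 1 x
interval-meet zero    zero    c zero    = refl
interval-meet zero    zero    c (suc x) = ∧-zeroʳ (x <ᵇ c)
interval-meet zero    (suc a) c zero    = refl
interval-meet zero    (suc a) c (suc x) = interval-meet zero a c x
interval-meet (suc b) a       c zero    = refl
interval-meet (suc b) a       c (suc x) = interval-meet b a c x

interval-join : ∀ b a c x → interval b (suc a) x ∨ interval (b + a) (suc c) x ≡ interval b (suc (a + c)) x
interval-join zero    zero    c zero    = refl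
interval-join zero    zero    c (suc x) = refl
interval-join zero    (suc a) c zero    = refl
interval-join zero    (suc a) c (suc x) = interval-join zero a c x
interval-join (suc b) a       c zero    = refl
interval-join (suc b) a       c (suc x) = interval-join b a c x

∣tabulate∣ : ∀ L (f : ℕ → Bool) → ∣ tabulate {n = L} (f ∘ toℕ) ∣ ≡ count f L
∣tabulate∣ zero    f = refl
∣tabulate∣ (suc L) f with f zero
... | true  = cong suc (∣tabulate∣ L (f ∘ suc))
... | false = ∣tabulate∣ L (f ∘ suc)

tabulate-─ : ∀ {n} (f g : Fin n → Bool) → tabulate f ─ tabulate g ≡ tabulate (λ x → f x ∧ not (g x))
tabulate-─ {zero}  f g = refl
tabulate-─ {suc n} f g with f fzero | g fzero
... | true  | true  = cong (_∷_ false) (tabulate-─ (f ∘ Fin.suc) (g ∘ Fin.suc))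
... | false | true  = cong (_∷_ false) (tabulate-─ (f ∘ Fin.suc) (g ∘ Fin.suc))
... | true  | false = cong (_∷_ true) (tabulate-─ (f ∘ Fin.suc) (g ∘ Fin.suc))
... | false | false = cong (_∷_ false) (tabulate-─ (f ∘ Fin.suc) (g ∘ Fin.suc))

∣tabulate─tabulate∣ : ∀ L (f g : ℕ → Bool) →
  ∣ tabulate {n = L} (f ∘ toℕ) ─ tabulate (g ∘ toℕ) ∣ ≡ count (λ x → f x ∧ not (g x)) L
∣tabulate─tabulate∣ L f g = trans (cong ∣_∣ (tabulate-─ {L} (f ∘ toℕ) (g ∘ toℕ))) (∣tabulate∣ L (λ x → f x ∧ not (g x)))

∣++∣ : ∀ {m n} (s : Subset m) (t : Subset n) → ∣ s ++ t ∣ ≡ ∣ s ∣ + ∣ t ∣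
∣++∣ []            t = refl
∣++∣ (inside ∷ s)  t = cong suc (∣++∣ s t)
∣++∣ (outside ∷ s) t = ∣++∣ s t

-- Two copies of the point set followed by one extra point ∞, which lies in every doubled block.
doubled : Subset n → Subset (n + (n + 1))
doubled s = s ++ (s ++ [ inside ])

∣doubled∣ : (s : Subset n) → ∣ doubled s ∣ ≡ ∣ s ∣ + (∣ s ∣ + 1)
∣doubled∣ s = trans (∣++∣ s _) (cong (∣ s ∣ +_) (∣++∣ s _))

∣doubled─doubled∣ : (s t : Subset n) → ∣ doubled s ─ doubled t ∣ ≡ ∣ s ─ t ∣ + (∣ s ─ t ∣ + 0)
∣doubled─doubled∣ s t = begin
  ∣ doubled s ─ doubled t ∣                         ≡⟨ cong ∣_∣ (zipWith-++ _ s _ t _) ⟩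
  ∣ (s ─ t) ++ ((s ++ [ inside ]) ─ (t ++ [ inside ])) ∣ ≡⟨ cong (λ u → ∣ (s ─ t) ++ u ∣) (zipWith-++ _ s _ t _) ⟩
  ∣ (s ─ t) ++ ((s ─ t) ++ [ outside ]) ∣            ≡⟨ trans (∣++∣ (s ─ t) _) (cong (∣ s ─ t ∣ +_) (∣++∣ (s ─ t) _)) ⟩
  ∣ s ─ t ∣ + (∣ s ─ t ∣ + 0)                        ∎
  where open ≡-Reasoning

SingleChange : Subset n → Subset n → Set
SingleChange s t = (∣ s ─ t ∣ ≡ 1) × (∣ t ─ s ∣ ≡ 1)

doubled-doubleChange : {s t : Subset n} → SingleChange s t → DoubleChange (doubled s) (doubled t)
doubled-doubleChange {s = s} {t} (s─t , t─s) =
  trans (∣doubled─doubled∣ s t) (cong (λ m → m + (m + 0)) s─t) ,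
  trans (∣doubled─doubled∣ t s) (cong (λ m → m + (m + 0)) t─s)

label : Fin (n + (n + 1)) → Maybe (Fin n)
label {n} x with splitAt n x
... | inj₁ u = just u
... | inj₂ y with splitAt n y
...   | inj₁ u = just u
...   | inj₂ _ = nothing

lookup-doubled : (s : Subset n) (x : Fin (n + (n + 1))) → lookup (doubled s) x ≡ maybe (lookup s) inside (label x)
lookup-doubled {n} s x rewrite lookup-splitAt n s (s ++ [ inside ]) x with splitAt n x
... | inj₁ u = refl
... | inj₂ y rewrite lookup-splitAt n s [ inside ] y with splitAt n y
...   | inj₁ u = refl
...   | inj₂ fzero = refl

∈-doubled : (s : Subset n) (x : Fin (n + (n + 1))) → All (_∈ s) (label x) → x ∈ doubled s
∈-doubled s x ps = lookup⇒[]= x (doubled s) (trans (lookup-doubled s x) (inside-label ps))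
  where
  inside-label : ∀ {m} → All (_∈ s) m → maybe (lookup s) inside m ≡ inside
  inside-label (just u∈s) = []=⇒lookup u∈s
  inside-label nothing    = refl

doubled-covers : (B : ℕ → Subset n) → 0 < b →
  (∀ u w → Σ ℕ λ i → i < b × u ∈ B i × w ∈ B i) →
  ∀ x y → Σ ℕ λ i → i < b × x ∈ doubled (B i) × y ∈ doubled (B i)
doubled-covers {n} {b} B 0<b covers x y with cover-labels (label x) (label y)
  where
  cover-labels : ∀ l m → Σ ℕ λ i → i < b × All (_∈ B i) l × All (_∈ B i) m
  cover-labels (just u) (just w) = let (i , i<b , u∈ , w∈) = covers u w in i , i<b , just u∈ , just w∈
  cover-labels (just u) nothing  = let (i , i<b , u∈ , _) = covers u u in i , i<b , just u∈ , nothing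
  cover-labels nothing  (just w) = let (i , i<b , w∈ , _) = covers w w in i , i<b , nothing , just w∈
  cover-labels nothing  nothing  = 0 , 0<b , nothing , nothing
... | i , i<b , px , py = i , i<b , ∈-doubled (B i) x px , ∈-doubled (B i) y py

fromBlockSequence : ∀ {v k b} (B : ℕ → Subset v) →
  (∀ i → i < b → ∣ B i ∣ ≡ k) →
  (∀ x y → Σ ℕ λ i → i < b × x ∈ B i × y ∈ B i) →
  (∀ i → suc i < b → DoubleChange (B i) (B (suc i))) →
  (2 ≤ b → DoubleChange (B (b ∸ 1)) (B 0)) →
  CDCCD v k b
fromBlockSequence {b = b} B size covers consecutive circular = record
  { block       = B ∘ toℕ
  ; blockSize   = λ j → size (toℕ j) (toℕ<n j)
  ; covers      = λ x y → let (i , i<b , x∈ , y∈) = covers x y in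
                    fromℕ< i<b , subst (λ j → x ∈ B j × y ∈ B j) (sym (toℕ-fromℕ< i<b)) (x∈ , y∈)
  ; consecutive = λ i i+1<b → subst₂ (λ j j' → DoubleChange (B j) (B j'))
                    (sym (toℕ-fromℕ< _)) (sym (toℕ-fromℕ< i+1<b)) (consecutive i i+1<b)
  ; circular    = λ 0<b b-1<b 2≤b → subst₂ (λ j j' → DoubleChange (B j) (B j'))
                    (sym (toℕ-fromℕ< b-1<b)) (sym (toℕ-fromℕ< 0<b)) (circular 2≤b)
  }

n+n>0⇒n>0 : 0 < n + n → 0 < n
n+n>0⇒n>0 {suc n} _ = z<s

module CyclicWindows (p : ℕ) where

  N : ℕ
  N = suc (p + p)

  -- Window i is the cyclic interval {i, …, i + p} of ℤ_N; past the middle it wraps around,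
  -- and is then written as the complement of the p points it misses.
  window : ℕ → ℕ → Bool
  window i x = if does (i ≤? p) then interval i (suc p) x else not (interval (i ∸ p) p x)

  window-low : i ≤ p → ∀ x → window i x ≡ interval i (suc p) x
  window-low {i} i≤p x rewrite dec-true (i ≤? p) i≤p = refl

  window-high : ∀ s x → window (suc s + p) x ≡ not (interval (suc s) p x)
  window-high s x rewrite dec-false (suc s + p ≤? p) (<⇒≱ (m<n+m p z<s)) | m+n∸n≡m (suc s) p = refl

  data Half : ℕ → Set where
    lower : ∀ {i} → i ≤ p → Half i
    upper : ∀ s → Half (suc s + p)

  half : ∀ i → Half i
  half i with i ≤? p
  ... | yes i≤p = lower i≤p
  ... | no  i≰p = let (s , p+1+s≡i) = m≤n⇒∃[o]m+o≡n (≰⇒> i≰p) in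
                  subst Half (trans (cong suc (+-comm s p)) p+1+s≡i) (upper s)

  p<N : p < N
  p<N = s≤s (m≤m+n p p)

  windowSubset : ℕ → Subset N
  windowSubset i = tabulate (window i ∘ toℕ)

  ∈-windowSubset : ∀ i (u : Fin N) → window i (toℕ u) ≡ true → u ∈ windowSubset i
  ∈-windowSubset i u u∈ = lookup⇒[]= u (windowSubset i) (trans (lookup∘tabulate (window i ∘ toℕ) u) u∈)

  ∣windowSubset∣ : i < N → ∣ windowSubset i ∣ ≡ suc p
  ∣windowSubset∣ {i} i<N = trans (∣tabulate∣ N (window i)) (size (half i) i<N)
    where
    size : ∀ {i} → Half i → i < N → count (window i) N ≡ suc p
    size {i} (lower i≤p) _ = trans (count-cong N (window-low i≤p))
      (count-interval i (suc p) N (subst (_≤ N) (sym (+-suc i p)) (s≤s (+-monoˡ-≤ p i≤p))))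
    size (upper s) i<N = trans (count-cong N (window-high s))
      (trans (count-complement (suc s) p N (<⇒≤ i<N)) (m+n∸n≡m (suc p) p))

  Δ : ℕ → ℕ → ℕ → Bool
  Δ i j x = window i x ∧ not (window j x)

  Δ-≡ : ∀ i j x {u w} → window i x ≡ u → window j x ≡ w → Δ i j x ≡ u ∧ not w
  Δ-≡ i j x = cong₂ (λ u w → u ∧ not w)

  windowChange : ∀ i j → count (Δ i j) N ≡ 1 → count (Δ j i) N ≡ 1 →
    SingleChange (windowSubset i) (windowSubset j)
  windowChange i j ij ji =
    trans (∣tabulate─tabulate∣ N (window i) (window j)) ij ,
    trans (∣tabulate─tabulate∣ N (window j) (window i)) ji

  not-∧-not-not : ∀ u w → not u ∧ not (not w) ≡ w ∧ not u
  not-∧-not-not u w rewrite not-involutive w = ∧-comm (not u) w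

  lowChange : suc i ≤ p → SingleChange (windowSubset i) (windowSubset (suc i))
  lowChange {i} i<p = windowChange i (suc i)
    (trans (count-cong N leaving) (count-point i N (<-trans i<p p<N)))
    (trans (count-cong N entering) (count-point (i + suc p) N i+p+1<N))
    where
    i+p+1<N : i + suc p < N
    i+p+1<N = s≤s (subst (_≤ p + p) (sym (+-suc i p)) (+-monoˡ-≤ p i<p))
    leaving : ∀ x → Δ i (suc i) x ≡ interval i 1 x
    leaving x = trans (Δ-≡ i (suc i) x (window-low (<⇒≤ i<p) x) (window-low i<p x)) (interval-shiftˡ i (suc p) x)
    entering : ∀ x → Δ (suc i) i x ≡ interval (i + suc p) 1 x
    entering x = trans (Δ-≡ (suc i) i x (window-low i<p x) (window-low (<⇒≤ i<p) x)) (interval-shiftʳ i (suc p) x)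

  highChange : ∀ s → suc (suc s) ≤ p → SingleChange (windowSubset (suc s + p)) (windowSubset (suc (suc s) + p))
  highChange s s+2≤p = windowChange (suc s + p) (suc (suc s) + p)
    (trans (count-cong N leaving) (count-point (suc s + p) N (s≤s (+-monoˡ-≤ p (<⇒≤ s+2≤p)))))
    (trans (count-cong N entering) (count-point (suc s) N (<-trans s+2≤p p<N)))
    where
    instance
      p≢0 : NonZero p
      p≢0 = >-nonZero (≤-trans (s≤s z≤n) s+2≤p)
    leaving : ∀ x → Δ (suc s + p) (suc (suc s) + p) x ≡ interval (suc s + p) 1 x
    leaving x = trans (Δ-≡ (suc s + p) (suc (suc s) + p) x (window-high s x) (window-high (suc s) x))
      (trans (not-∧-not-not (interval (suc s) p x) (interval (suc (suc s)) p x)) (interval-shiftʳ (suc s) p x))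
    entering : ∀ x → Δ (suc (suc s) + p) (suc s + p) x ≡ interval (suc s) 1 x
    entering x = trans (Δ-≡ (suc (suc s) + p) (suc s + p) x (window-high (suc s) x) (window-high s x))
      (trans (not-∧-not-not (interval (suc (suc s)) p x) (interval (suc s) p x)) (interval-shiftˡ (suc s) p x))

  -- Matching on 0 < p instantiates p to suc q.
  middleChange : 0 < p → SingleChange (windowSubset p) (windowSubset (suc p))
  middleChange (z<s {q}) = windowChange p (suc p)
    (trans (count-cong N leaving) (count-point p N p<N))
    (trans (count-cong N entering) (trans (count-complement 1 (suc (q + p)) N ≤-refl) (m+n∸n≡m 1 (suc (q + p)))))
    where
    leaving : ∀ x → Δ p (suc p) x ≡ interval p 1 x
    leaving x = begin
      Δ p (suc p) x                        ≡⟨ Δ-≡ p (suc p) x (window-low ≤-refl x) (window-high 0 x) ⟩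
      interval p (suc p) x ∧ not (not (interval 1 p x)) ≡⟨ cong (interval p (suc p) x ∧_) (not-involutive _) ⟩
      interval p (suc p) x ∧ interval 1 p x ≡⟨ interval-meet 1 q p x ⟩
      interval p 1 x                       ∎
      where open ≡-Reasoning
    entering : ∀ x → Δ (suc p) p x ≡ not (interval 1 (suc (q + p)) x)
    entering x = begin
      Δ (suc p) p x                                      ≡⟨ Δ-≡ (suc p) p x (window-high 0 x) (window-low ≤-refl x) ⟩
      not (interval 1 p x) ∧ not (interval p (suc p) x)  ≡⟨ deMorgan₂ (interval 1 p x) (interval p (suc p) x) ⟨
      not (interval 1 p x ∨ interval p (suc p) x)        ≡⟨ cong not (interval-join 1 q p x) ⟩
      not (interval 1 (suc (q + p)) x)                   ∎
      where open ≡-Reasoning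

  wrapChange : 0 < p → SingleChange (windowSubset (p + p)) (windowSubset 0)
  wrapChange (z<s {q}) = windowChange (p + p) 0
    (trans (count-cong N leaving) (trans (count-complement 0 (suc (p + q)) N (<⇒≤ p+q<N)) N∸[p+q+1]≡1))
    (trans (count-cong N entering) (count-point p N p<N))
    where
    p+q<N : suc (p + q) < N
    p+q<N = s≤s (≤-reflexive (sym (+-suc p q)))
    N∸[p+q+1]≡1 : N ∸ suc (p + q) ≡ 1
    N∸[p+q+1]≡1 = trans (cong (λ m → suc m ∸ suc (p + q)) (+-suc p q)) (m+n∸n≡m 1 (suc (p + q)))
    leaving : ∀ x → Δ (p + p) 0 x ≡ not (interval 0 (suc (p + q)) x)
    leaving x = begin
      Δ (p + p) 0 x                                       ≡⟨ Δ-≡ (p + p) 0 x (window-high q x) (window-low z≤n x) ⟩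
      not (interval p p x) ∧ not (interval 0 (suc p) x)   ≡⟨ ∧-comm (not (interval p p x)) _ ⟩
      not (interval 0 (suc p) x) ∧ not (interval p p x)   ≡⟨ deMorgan₂ (interval 0 (suc p) x) (interval p p x) ⟨
      not (interval 0 (suc p) x ∨ interval p p x)         ≡⟨ cong not (interval-join 0 p q x) ⟩
      not (interval 0 (suc (p + q)) x)                    ∎
      where open ≡-Reasoning
    entering : ∀ x → Δ 0 (p + p) x ≡ interval p 1 x
    entering x = begin
      Δ 0 (p + p) x                                       ≡⟨ Δ-≡ 0 (p + p) x (window-low z≤n x) (window-high q x) ⟩
      interval 0 (suc p) x ∧ not (not (interval p p x))   ≡⟨ cong (interval 0 (suc p) x ∧_) (not-involutive _) ⟩
      interval 0 (suc p) x ∧ interval p p x               ≡⟨ ∧-comm (interval 0 (suc p) x) _ ⟩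
      interval p p x ∧ interval 0 (suc p) x               ≡⟨ interval-meet 0 p q x ⟩
      interval p 1 x                                      ∎
      where open ≡-Reasoning

  consecutiveChange : ∀ i → suc i < N → SingleChange (windowSubset i) (windowSubset (suc i))
  consecutiveChange i i+1<N with half i
  ... | upper s = highChange s (+-cancelʳ-≤ p (suc (suc s)) p (≤-pred i+1<N))
  ... | lower i≤p with m≤n⇒m<n∨m≡n i≤p
  ...   | inj₁ i<p  = lowChange i<p
  ...   | inj₂ refl = middleChange (n+n>0⇒n>0 (≤-trans (s≤s z≤n) (≤-pred i+1<N)))

  beyond-middle : ∀ {x} → p < x → window (suc p) x ≡ true
  beyond-middle {x} p<x = trans (window-high 0 x) (cong not (interval-≥ {1} {p} {x} p<x))

  windows-cover≤ : ∀ {a c} → a ≤ c → c < N → Σ ℕ λ i → i < N × window i a ≡ true × window i c ≡ true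
  windows-cover≤ {a} {c} a≤c c<N with half a
  ... | upper t = suc p , ≤-<-trans (≤-trans p<a a≤c) c<N , beyond-middle p<a , beyond-middle (<-≤-trans p<a a≤c)
    where
    p<a : p < suc t + p
    p<a = s≤s (m≤n+m p t)
  ... | lower a≤p with c ≤? a + p
  ...   | yes c≤a+p = a , ≤-<-trans a≤p p<N , in-window ≤-refl (m<m+n a z<s) , in-window a≤c c<a+p+1
    where
    in-window : ∀ {x} → a ≤ x → x < a + suc p → window a x ≡ true
    in-window {x} a≤x x<a+p+1 = trans (window-low a≤p x) (interval-≤< a≤x x<a+p+1)
    c<a+p+1 : c < a + suc p
    c<a+p+1 = subst (c <_) (sym (+-suc a p)) (s≤s c≤a+p)
  ...   | no c≰a+p with half c
  ...     | lower c≤p = contradiction (≤-trans c≤p (m≤n+m p a)) c≰a+p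
  ...     | upper s = suc s + p , c<N ,
                      trans (window-high s a) (cong not (interval-< a<1+s)) ,
                      trans (window-high s (suc s + p)) (cong not (interval-≥ {suc s} {p} ≤-refl))
    where
    a<1+s : a < suc s
    a<1+s = +-cancelʳ-< p a (suc s) (≰⇒> c≰a+p)

  windows-cover : ∀ (u w : Fin N) → Σ ℕ λ i → i < N × u ∈ windowSubset i × w ∈ windowSubset i
  windows-cover u w with ≤-total (toℕ u) (toℕ w)
  ... | inj₁ u≤w = let (i , i<N , u∈ , w∈) = windows-cover≤ u≤w (toℕ<n w) in
                   i , i<N , ∈-windowSubset i u u∈ , ∈-windowSubset i w w∈
  ... | inj₂ w≤u = let (i , i<N , w∈ , u∈) = windows-cover≤ w≤u (toℕ<n u) in
                   i , i<N , ∈-windowSubset i u u∈ , ∈-windowSubset i w w∈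

  design : CDCCD (N + (N + 1)) (suc p + (suc p + 1)) N
  design = fromBlockSequence (doubled ∘ windowSubset)
    (λ i i<N → trans (∣doubled∣ (windowSubset i)) (cong (λ m → m + (m + 1)) (∣windowSubset∣ i<N)))
    (doubled-covers windowSubset z<s windows-cover)
    (λ i i+1<N → doubled-doubleChange {s = windowSubset i} {windowSubset (suc i)} (consecutiveChange i i+1<N))
    (λ 2≤N → doubled-doubleChange {s = windowSubset (p + p)} {windowSubset 0} (wrapChange (n+n>0⇒n>0 (≤-pred 2≤N))))

2*nC2+n≡n*n : ∀ n → 2 * (n C 2) + n ≡ n * n
2*nC2+n≡n*n zero    = refl
2*nC2+n≡n*n (suc n) = begin
  2 * (suc n C 2) + suc n           ≡⟨ cong (λ c → 2 * c + suc n) pascal ⟩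
  2 * (n + n C 2) + suc n           ≡⟨ regroup n (n C 2) ⟩
  (2 * (n C 2) + n) + (n + suc n)   ≡⟨ cong (_+ (n + suc n)) (2*nC2+n≡n*n n) ⟩
  n * n + (n + suc n)               ≡⟨ next-square n ⟩
  suc n * suc n                     ∎
  where
  open ≡-Reasoning
  pascal : suc n C 2 ≡ n + n C 2
  pascal = trans (sym (nCk+nC[k+1]≡[n+1]C[k+1] n 1)) (cong (_+ n C 2) (nC1≡n n))
  regroup : ∀ n c → 2 * (n + c) + suc n ≡ (2 * c + n) + (n + suc n)
  regroup = solve-∀
  next-square : ∀ n → n * n + (n + suc n) ≡ suc n * suc n
  next-square = solve-∀

[n+[n+1]]C2≡n*[n+[n+1]] : ∀ n → (n + (n + 1)) C 2 ≡ n * (n + (n + 1))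
[n+[n+1]]C2≡n*[n+[n+1]] n = *-cancelˡ-≡ _ _ 2
  (+-cancelʳ-≡ (n + (n + 1)) _ _ (trans (2*nC2+n≡n*n (n + (n + 1))) (odd-square n)))
  where
  odd-square : ∀ n → (n + (n + 1)) * (n + (n + 1)) ≡ 2 * (n * (n + (n + 1))) + (n + (n + 1))
  odd-square = solve-∀

ceilDiv-* : ∀ m n .{{_ : NonZero n}} → ceilDiv (m * n) n ≡ m
ceilDiv-* m n@(suc d) = begin
  (m * n + d) / n        ≡⟨ +-distrib-/-∣ˡ d (divides m refl) ⟩
  m * n / n + d / n      ≡⟨ cong₂ _+_ (m*n/n≡m m n) (m<n⇒m/n≡0 ≤-refl) ⟩
  m + 0                  ≡⟨ +-identityʳ m ⟩
  m                      ∎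
  where open ≡-Reasoning

tight : ∀ n k → 2 * k ∸ 3 ≡ n + (n + 1) → Tight (n + (n + 1)) k n
tight n k 2k∸3≡v = subst (λ d → (n ≡ ceilDiv (v C 2) d) × (d ∣ v C 2)) (sym 2k∸3≡v)
  (sym (trans (cong (λ c → ceilDiv c v) ([n+[n+1]]C2≡n*[n+[n+1]] n)) (ceilDiv-* n v)) ,
   divides n ([n+[n+1]]C2≡n*[n+[n+1]] n))
  where
  v : ℕ
  v = n + (n + 1)
  instance
    v≢0 : NonZero v
    v≢0 = >-nonZero (≤-trans (m≤n+m 1 n) (m≤n+m (n + 1) n))

mainTheorem4 : (k : ℕ) → Σ ℕ (λ m → k ≡ suc (2 * m)) → 3 ≤ k →
    CDCCD (2 * k ∸ 3) k (k ∸ 2) × Tight (2 * k ∸ 3) k (k ∸ 2)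
mainTheorem4 k (zero , refl) (s≤s ())
mainTheorem4 k (suc p , refl) _ =
  subst₂ (λ v b → CDCCD v k b × Tight v k b) (sym v≡) (sym b≡)
    (subst (λ k → CDCCD (N + (N + 1)) k N) (sym k≡) design , tight N k v≡)
  where
  open CyclicWindows p
  v≡ : 2 * k ∸ 3 ≡ N + (N + 1)
  v≡ = trans (cong (_∸ 3) (twice p)) (m+n∸m≡n 3 _)
    where
    twice : ∀ p → 2 * suc (2 * suc p) ≡ 3 + (suc (p + p) + (suc (p + p) + 1))
    twice = solve-∀
  b≡ : k ∸ 2 ≡ N
  b≡ = trans (cong (_∸ 2) (shift p)) (m+n∸m≡n 2 _)
    where
    shift : ∀ p → suc (2 * suc p) ≡ 2 + suc (p + p)
    shift = solve-∀
  k≡ : k ≡ suc p + (suc p + 1)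
  k≡ = halves p
    where
    halves : ∀ p → suc (2 * suc p) ≡ suc p + (suc p + 1)
    halves = solve-∀
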